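{- Let $n \ge 1$ and let $M$ be a complete binary tree with $m$ leaves numbered $1,\dots,m$ from left to right, where $m$ is a power of two with $n+1 \le m \le 2n$. Let $t$ be an integer and let each leaf $j \in \{1,\dots,n\}$ have a value $s(j)$ which is either $-\infty$ or an integer with $s(j) < t$. Suppose every node of $M$ is labelled active or passive, and call a node a leader if it is active and its parent is passive. Assume: (1) leaves $1,\dots,n$ are active and leaves $n+1,\dots,m$ passive; (2) the children of every active node are active; (3) if $u_1, u_2, \dots$ are the leaders in left-to-right order, then $|\mathrm{height}(u_j) - \mathrm{height}(u_{j+1})| \le 2$ for every $j$; (4) for every leaf $j \in \{1,\dots,n\}$ with $s(j) \neq -\infty$, the $\lceil \log_2(1 + t - s(j)) \rceil$-th ancestor of leaf $j$ is passive. Let $i \in \{1,\dots,n\}$ and let $v$ be the leader whose subtree contains leaf $i$. Then $\mathrm{height}(v) \le d(i) + 3$, where $d(i) = 1 + \min_{1 \le j \le n}\big(\log(1+|i-j|) + \log(1+t-s(j))\big)$.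
   Context: The height of a node is the height of its subtree in $M$ (leaves have height $0$). The $k$-th ancestor of a node is the node $k$ levels above it. Under (1) and (2), every leaf $1,\dots,n$ lies in the subtree of exactly one leader, and leaders' subtrees are disjoint, so leaders are ordered left to right. Logarithms are base 2; a term with $s(j) = -\infty$ is $+\infty$. -}

module Defs where

open import Data.Bool using (Bool; true; false)
open import Data.Nat using (ℕ; zero; suc; _+_; _*_; _∸_; _^_; _≤_; _<_; _/_)
open import Data.Nat.Logarithm using (⌈log₂_⌉)
open import Data.Nat.Properties using (m^n≢0)
open import Data.Integer as ℤ using (ℤ; ∣_∣)
open import Data.Product using (_×_)
open import Relation.Binary.PropositionalEquality using (_≡_)

-- The complete binary tree M of depth D has m = 2 ^ D leaves.
-- A node is a pair (h , p): h = its height (0 ≤ h ≤ D), p = its position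
-- among the nodes of height h, counted from the left from 0 (p < 2 ^ (D ∸ h)).
-- Leaf j (1-indexed, 1 ≤ j ≤ m) is the node (0 , j ∸ 1).
-- Children of (suc h , p) are (h , 2 * p) and (h , 2 * p + 1);
-- the parent of (h , p) (for h < D) is (suc h , p / 2);
-- the k-th ancestor of leaf j is (k , (j ∸ 1) / 2 ^ k) (exists iff k ≤ D).
-- The subtree of (h , p) contains exactly the leaves j with
-- p * 2 ^ h < j ≤ (p + 1) * 2 ^ h.

IsNode : ℕ → ℕ → ℕ → Set
IsNode D h p = (h ≤ D) × (p < 2 ^ (D ∸ h))

-- A labelling: true = active, false = passive.
Labelling : Set
Labelling = ℕ → ℕ → Bool

IsLeader : ℕ → Labelling → ℕ → ℕ → Set
IsLeader D act h p =
  IsNode D h p × (h < D) × (act h p ≡ true) × (act (suc h) (p / 2) ≡ false)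

LeafIn : ℕ → ℕ → ℕ → Set
LeafIn j h p = (p * 2 ^ h < j) × (j ≤ (suc p) * 2 ^ h)

-- the leader (h' , p') immediately follows the leader (h , p) in
-- left-to-right order: the leftmost leaf of (h' , p') is the leaf right after
-- the rightmost leaf of (h , p)
NextLeaf : ℕ → ℕ → ℕ → ℕ → Set
NextLeaf h p h' p' = (suc p) * 2 ^ h ≡ p' * 2 ^ h'

ancLevel : ℤ → ℤ → ℕ
ancLevel t k = ⌈log₂ ∣ ℤ.1ℤ ℤ.+ t ℤ.- k ∣ ⌉

ancPos : ℕ → ℕ → ℕ
ancPos j k = _/_ (j ∸ 1) (2 ^ k) {{m^n≢0 2 k}}

{-# OPTIONS --safe #-}

-- Let a = ⌈log₂ (1 + t − k)⌉, the level of the passive ancestor of leaf j given by (4).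
-- If a > h − 2, then 2 ^ (h − 2) ≤ 2 ^ (a − 1) ≤ 1 + t − k. Otherwise leaf j lies in no
-- leader of height ≥ h − 2, because everything below an active node is active. So j is
-- outside v and also outside the leader next to v on j's side, which by (3) has height
-- ≥ h − 2. Hence at least 2 ^ (h − 2) leaves separate i from j.

module Submission where

open import Defs
open import Data.Bool using (Bool; true; false)
open import Data.Nat
  using (ℕ; zero; suc; _+_; _*_; _∸_; _^_; _≤_; _<_; _/_; _%_; ∣_-_∣; s≤s; s≤s⁻¹; z≤n; NonZero;
         _≤′_; ≤′-refl; ≤′-step)
open import Data.Nat.Properties
open import Data.Nat.DivMod
open import Data.Nat.Logarithm using (⌈log₂_⌉; ⌈log₂⌉-mono-≤; ⌈log₂2^n⌉≡n)
open import Data.Integer as ℤ using (ℤ; +_)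
import Data.Integer.Properties as ℤₚ
open import Data.Maybe using (Maybe; just)
open import Data.Product using (∃-syntax; ∃₂; _×_; _,_; proj₂)
open import Data.Sum using (_⊎_; inj₁; inj₂)
open import Relation.Nullary using (¬_; yes; no; contradiction)
open import Relation.Binary.Definitions using (tri<; tri≈; tri>)
open import Relation.Binary.PropositionalEquality

m≡2*[m/2]⊎m≡2*[m/2]+1 : ∀ m → m ≡ 2 * (m / 2) ⊎ m ≡ 2 * (m / 2) + 1
m≡2*[m/2]⊎m≡2*[m/2]+1 m with m % 2 | m%n<n m 2 | m≡m%n+[m/n]*n m 2
... | 0 | _ | m≡ = inj₁ (trans m≡ (*-comm (m / 2) 2))
... | 1 | _ | m≡ = inj₂ (trans m≡ (trans (+-comm 1 (m / 2 * 2)) (cong (_+ 1) (*-comm (m / 2) 2))))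
... | suc (suc _) | s≤s (s≤s ()) | _

∣m-n∣≤o⇒m∸o≤n : ∀ m n o → ∣ m - n ∣ ≤ o → m ∸ o ≤ n
∣m-n∣≤o⇒m∸o≤n m n o ∣m-n∣≤o = m≤n+o⇒m∸n≤o m o (begin
  m              ≤⟨ m≤n+m∸n m n ⟩
  n + (m ∸ n)    ≤⟨ +-monoʳ-≤ n (≤-trans (m∸n≤∣m-n∣ m n) ∣m-n∣≤o) ⟩
  n + o          ≡⟨ +-comm n o ⟩
  o + n          ∎)
  where open ≤-Reasoning

m+o≤n⇒o≤∣m-n∣ : ∀ m n o → m + o ≤ n → o ≤ ∣ m - n ∣
m+o≤n⇒o≤∣m-n∣ m n o m+o≤n = subst (o ≤_) (sym (m≤n⇒∣m-n∣≡n∸m (≤-trans (m≤m+n m o) m+o≤n)))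
  (m+n≤o⇒m≤o∸n o (subst (_≤ n) (+-comm m o) m+o≤n))

2^[⌈log₂[1+n]⌉∸1]≤1+n : ∀ n → 2 ^ (⌈log₂ suc n ⌉ ∸ 1) ≤ suc n
2^[⌈log₂[1+n]⌉∸1]≤1+n n with ⌈log₂ suc n ⌉ in ⌈log₂n⌉≡
... | zero  = s≤s z≤n
... | suc b = ≮⇒≥ λ n<2^b → n≮n b (begin-strict
  b                    <⟨ n<1+n b ⟩
  suc b                ≡⟨ ⌈log₂n⌉≡ ⟨
  ⌈log₂ suc n ⌉        ≤⟨ ⌈log₂⌉-mono-≤ (<⇒≤ n<2^b) ⟩
  ⌈log₂ 2 ^ b ⌉        ≡⟨ ⌈log₂2^n⌉≡n b ⟩
  b                    ∎)
  where open ≤-Reasoning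

1+i-j≡+[1+∣i-j∣] : ∀ {i j} → j ℤ.≤ i → ℤ.1ℤ ℤ.+ i ℤ.- j ≡ + suc ℤ.∣ i ℤ.- j ∣
1+i-j≡+[1+∣i-j∣] {i} {j} j≤i = begin
  ℤ.1ℤ ℤ.+ i ℤ.- j          ≡⟨ ℤₚ.+-assoc ℤ.1ℤ i (ℤ.- j) ⟩
  ℤ.1ℤ ℤ.+ (i ℤ.- j)        ≡⟨ cong (λ z → ℤ.1ℤ ℤ.+ z) (ℤₚ.0≤i⇒+∣i∣≡i (ℤₚ.i≤j⇒0≤j-i j≤i)) ⟨
  + suc ℤ.∣ i ℤ.- j ∣       ∎
  where open ≡-Reasoning

switch-point : ∀ (f : ℕ → Bool) n → f 0 ≡ true → f n ≡ false →
               ∃[ h ] h < n × f h ≡ true × f (suc h) ≡ false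
switch-point f zero    f0 fn with () ← trans (sym f0) fn
switch-point f (suc n) f0 fn with f n in fn′
... | true  = n , ≤-refl , fn′ , fn
... | false with h , h<n , fh , fh+1 ← switch-point f n f0 fn′ = h , m<n⇒m<1+n h<n , fh , fh+1

ancPos-zero : ∀ x → ancPos x 0 ≡ x ∸ 1
ancPos-zero x = n/1≡n (x ∸ 1)

ancPos-suc : ∀ x h → ancPos x (suc h) ≡ ancPos x h / 2
ancPos-suc x h = begin
  (x ∸ 1) / (2 * 2 ^ h)   ≡⟨ /-congʳ (*-comm 2 (2 ^ h)) ⟩
  (x ∸ 1) / (2 ^ h * 2)   ≡⟨ m/n/o≡m/[n*o] (x ∸ 1) (2 ^ h) 2 ⟨
  (x ∸ 1) / 2 ^ h / 2     ∎
  where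
  open ≡-Reasoning
  instance
    2^h≢0 : NonZero (2 ^ h)
    2^h≢0 = m^n≢0 2 h
    2^[1+h]≢0 : NonZero (2 ^ suc h)
    2^[1+h]≢0 = m^n≢0 2 (suc h)
    2^h*2≢0 : NonZero (2 ^ h * 2)
    2^h*2≢0 = m*n≢0 (2 ^ h) 2

leafIn⇒≡ancPos : ∀ x h {p} → LeafIn x h p → p ≡ ancPos x h
leafIn⇒≡ancPos zero    h (() , _)
leafIn⇒≡ancPos (suc x) h {p} (start<x , x≤end) = ≤-antisym p≤ ≤p
  where
  instance
    2^h≢0 : NonZero (2 ^ h)
    2^h≢0 = m^n≢0 2 h
  p≤ : p ≤ x / 2 ^ h
  p≤ = subst (_≤ x / 2 ^ h) (m*n/n≡m p (2 ^ h)) (/-monoˡ-≤ (2 ^ h) (s≤s⁻¹ start<x))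
  ≤p : x / 2 ^ h ≤ p
  ≤p = s≤s⁻¹ (m<n*o⇒m/o<n x≤end)

leafIn-ancPos : ∀ x h → LeafIn (suc x) h (ancPos (suc x) h)
leafIn-ancPos x h = s≤s (m/n*n≤m x (2 ^ h)) , (begin
  suc x                                    ≡⟨ cong suc (m≡m%n+[m/n]*n x (2 ^ h)) ⟩
  suc (x % 2 ^ h + x / 2 ^ h * 2 ^ h)      ≤⟨ +-monoˡ-≤ (x / 2 ^ h * 2 ^ h) (m%n<n x (2 ^ h)) ⟩
  2 ^ h + x / 2 ^ h * 2 ^ h                ∎)
  where
  open ≤-Reasoning
  instance
    2^h≢0 : NonZero (2 ^ h)
    2^h≢0 = m^n≢0 2 h

ancPos-isNode : ∀ D {x h} → x ≤ 2 ^ D → h ≤ D → IsNode D h (ancPos x h)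
ancPos-isNode D {x} {h} x≤2^D h≤D = h≤D , m<n*o⇒m/o<n (begin-strict
  x ∸ 1                 <⟨ m≤pred[n]⇒suc[m]≤n {{m^n≢0 2 D}} (pred-mono-≤ x≤2^D) ⟩
  2 ^ D                 ≡⟨ cong (2 ^_) (m∸n+n≡m h≤D) ⟨
  2 ^ (D ∸ h + h)       ≡⟨ ^-distribˡ-+-* 2 (D ∸ h) h ⟩
  2 ^ (D ∸ h) * 2 ^ h   ∎)
  where
  open ≤-Reasoning
  instance
    2^h≢0 : NonZero (2 ^ h)
    2^h≢0 = m^n≢0 2 h

ancPos-root : ∀ D {x} → x ≤ 2 ^ D → ancPos x D ≡ 0
ancPos-root D {x} x≤2^D =
  n<1⇒n≡0 (subst (λ e → ancPos x D < 2 ^ e) (n∸n≡0 D) (proj₂ (ancPos-isNode D x≤2^D ≤-refl)))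

first-leafIn : ∀ h p → LeafIn (suc (p * 2 ^ h)) h p
first-leafIn h p = ≤-refl , +-monoˡ-≤ (p * 2 ^ h) (m^n>0 2 h)

last-leafIn : ∀ h p → LeafIn (suc p * 2 ^ h) h p
last-leafIn h p = m<n+m (p * 2 ^ h) (m^n>0 2 h) , ≤-refl

ActiveClosed : ℕ → Labelling → Set
ActiveClosed D act = ∀ h p → IsNode D (suc h) p → act (suc h) p ≡ true →
  (act h (2 * p) ≡ true) × (act h (2 * p + 1) ≡ true)

Balanced : ℕ → Labelling → Set
Balanced D act = ∀ h p h′ p′ → IsLeader D act h p → IsLeader D act h′ p′ →
  NextLeaf h p h′ p′ → ∣ h - h′ ∣ ≤ 2

LeaderOf : ℕ → Labelling → ℕ → Set
LeaderOf D act x = ∃₂ λ h p → IsLeader D act h p × LeafIn x h p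

InNoLeaderOfHeight≥ : ℕ → Labelling → ℕ → ℕ → Set
InNoLeaderOfHeight≥ D act h₀ x = ∀ {h p} → IsLeader D act h p → h₀ ≤ h → ¬ LeafIn x h p

module _ {D : ℕ} {act : Labelling} (balanced : Balanced D act) where

  gap-before : ∀ {h p h′ p′ j} → IsLeader D act h′ p′ → IsLeader D act h p → NextLeaf h′ p′ h p →
    j ≤ p * 2 ^ h → InNoLeaderOfHeight≥ D act (h ∸ 2) j → j + 2 ^ (h ∸ 2) ≤ p * 2 ^ h
  gap-before {h} {p} {h′} {p′} {j} u v u→v j≤L avoids = begin
    j + 2 ^ (h ∸ 2)          ≤⟨ +-mono-≤ j≤start (^-monoʳ-≤ 2 h∸2≤h′) ⟩
    p′ * 2 ^ h′ + 2 ^ h′     ≡⟨ +-comm (p′ * 2 ^ h′) (2 ^ h′) ⟩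
    suc p′ * 2 ^ h′          ≡⟨ u→v ⟩
    p * 2 ^ h                ∎
    where
    open ≤-Reasoning
    h∸2≤h′ : h ∸ 2 ≤ h′
    h∸2≤h′ = ∣m-n∣≤o⇒m∸o≤n h h′ 2 (subst (_≤ 2) (∣-∣-comm h′ h) (balanced _ _ _ _ u v u→v))
    j≤start : j ≤ p′ * 2 ^ h′
    j≤start = ≮⇒≥ λ start<j → avoids u h∸2≤h′ (start<j , ≤-trans j≤L (≤-reflexive (sym u→v)))

  gap-after : ∀ {h p h′ p′ j} → IsLeader D act h p → IsLeader D act h′ p′ → NextLeaf h p h′ p′ →
    suc p * 2 ^ h < j → InNoLeaderOfHeight≥ D act (h ∸ 2) j → suc p * 2 ^ h + 2 ^ (h ∸ 2) ≤ j
  gap-after {h} {p} {h′} {p′} {j} v u v→u R<j avoids = begin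
    suc p * 2 ^ h + 2 ^ (h ∸ 2)  ≤⟨ +-monoʳ-≤ (suc p * 2 ^ h) (^-monoʳ-≤ 2 h∸2≤h′) ⟩
    suc p * 2 ^ h + 2 ^ h′       ≡⟨ cong (_+ 2 ^ h′) v→u ⟩
    p′ * 2 ^ h′ + 2 ^ h′         ≡⟨ +-comm (p′ * 2 ^ h′) (2 ^ h′) ⟩
    suc p′ * 2 ^ h′              ≤⟨ <⇒≤ end<j ⟩
    j                            ∎
    where
    open ≤-Reasoning
    h∸2≤h′ : h ∸ 2 ≤ h′
    h∸2≤h′ = ∣m-n∣≤o⇒m∸o≤n h h′ 2 (balanced _ _ _ _ v u v→u)
    end<j : suc p′ * 2 ^ h′ < j
    end<j = ≰⇒> λ j≤end → avoids u h∸2≤h′ (subst (_< j) v→u R<j , j≤end)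

module _ {D : ℕ} {act : Labelling} (closed : ActiveClosed D act) where

  active-parent⇒active : ∀ {h} q → IsNode D (suc h) (q / 2) → act (suc h) (q / 2) ≡ true →
                          act h q ≡ true
  active-parent⇒active {h} q node active with closed h (q / 2) node active | m≡2*[m/2]⊎m≡2*[m/2]+1 q
  ... | even , _ | inj₁ q≡ = subst (λ r → act h r ≡ true) (sym q≡) even
  ... | _ , odd  | inj₂ q≡ = subst (λ r → act h r ≡ true) (sym q≡) odd

  active-ancestor-step : ∀ {x h} → x ≤ 2 ^ D → suc h ≤ D →
    act (suc h) (ancPos x (suc h)) ≡ true → act h (ancPos x h) ≡ true
  active-ancestor-step {x} {h} x≤2^D h<D active
    with ancPos x (suc h) | ancPos-suc x h | ancPos-isNode D x≤2^D h<D
  ... | _ | refl | node = active-parent⇒active (ancPos x h) node active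

  active-below : ∀ {x a h} → x ≤ 2 ^ D → h ≤ D → a ≤ h →
    act h (ancPos x h) ≡ true → act a (ancPos x a) ≡ true
  active-below {x} x≤2^D h≤D a≤h = go h≤D (≤⇒≤′ a≤h)
    where
    go : ∀ {a h} → h ≤ D → a ≤′ h → act h (ancPos x h) ≡ true → act a (ancPos x a) ≡ true
    go h≤D ≤′-refl          active = active
    go h≤D (≤′-step a≤′h)   active = go (<⇒≤ h≤D) a≤′h (active-ancestor-step x≤2^D h≤D active)

  passive-leaf⇒passive-root : ∀ {x} → x ≤ 2 ^ D → act 0 (x ∸ 1) ≡ false → act D 0 ≡ false
  passive-leaf⇒passive-root {x} x≤2^D leaf with act D 0 in root
  ... | false = refl
  ... | true with () ← trans (sym leaf) (subst (λ q → act 0 q ≡ true) (ancPos-zero x)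
                          (active-below x≤2^D ≤-refl z≤n
                            (subst (λ q → act D q ≡ true) (sym (ancPos-root D x≤2^D)) root)))

  leader-active-below : ∀ {x a h p} → x ≤ 2 ^ D → IsLeader D act h p → LeafIn x h p → a ≤ h →
    act a (ancPos x a) ≡ true
  leader-active-below {x} {h = h} x≤2^D ((h≤D , _) , _ , active , _) x∈ a≤h =
    active-below x≤2^D h≤D a≤h (subst (λ q → act h q ≡ true) (leafIn⇒≡ancPos x h x∈) active)

  leader-parent-passive : ∀ {x h p} → IsLeader D act h p → LeafIn x h p →
    act (suc h) (ancPos x (suc h)) ≡ false
  leader-parent-passive {x} {h} {p} (_ , _ , _ , parent) x∈ =
    subst (λ q → act (suc h) q ≡ false)
      (trans (cong (_/ 2) (leafIn⇒≡ancPos x h {p} x∈)) (sym (ancPos-suc x h))) parent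

  leader-height-unique : ∀ {x h p h′ p′} → x ≤ 2 ^ D → IsLeader D act h p → IsLeader D act h′ p′ →
    LeafIn x h p → LeafIn x h′ p′ → h ≡ h′
  leader-height-unique {h = h} {h′ = h′} x≤2^D v u x∈v x∈u with <-cmp h h′
  ... | tri≈ _ h≡h′ _ = h≡h′
  ... | tri< h<h′ _ _ with () ← trans (sym (leader-parent-passive v x∈v))
                                      (leader-active-below x≤2^D u x∈u h<h′)
  ... | tri> _ _ h′<h with () ← trans (sym (leader-parent-passive u x∈u))
                                      (leader-active-below x≤2^D v x∈v h′<h)

  leader-unique : ∀ {x h p h′ p′} → x ≤ 2 ^ D → IsLeader D act h p → IsLeader D act h′ p′ →
    LeafIn x h p → LeafIn x h′ p′ → h ≡ h′ × p ≡ p′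
  leader-unique {x} {h} x≤2^D v u x∈v x∈u with refl ← leader-height-unique x≤2^D v u x∈v x∈u =
    refl , trans (leafIn⇒≡ancPos x h x∈v) (sym (leafIn⇒≡ancPos x h x∈u))

  passive-ancestor⇒inNoLeader : ∀ {x a} → x ≤ 2 ^ D → act a (ancPos x a) ≡ false →
    InNoLeaderOfHeight≥ D act a x
  passive-ancestor⇒inNoLeader x≤2^D passive u a≤h x∈u
    with () ← trans (sym passive) (leader-active-below x≤2^D u x∈u a≤h)

  leader-of : ∀ {x} → act D 0 ≡ false → x ≤ 2 ^ D → 1 ≤ x → act 0 (x ∸ 1) ≡ true → LeaderOf D act x
  leader-of {x@(suc y)} root x≤2^D _ leaf
    with h , h<D , active , parent ← switch-point (λ h → act h (ancPos x h)) D
           (subst (λ q → act 0 q ≡ true) (sym (ancPos-zero x)) leaf)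
           (subst (λ q → act D q ≡ false) (sym (ancPos-root D x≤2^D)) root)
    = h , ancPos x h
    , (ancPos-isNode D x≤2^D (<⇒≤ h<D) , h<D , active ,
       subst (λ q → act (suc h) q ≡ false) (ancPos-suc x h) parent)
    , leafIn-ancPos y h

  -- The leader containing the leaf right after v starts there: otherwise it would also
  -- contain the last leaf of v, and so be v.
  leader-after : ∀ {h p h′ p′} → suc p * 2 ^ h ≤ 2 ^ D → IsLeader D act h p → IsLeader D act h′ p′ →
    LeafIn (suc (suc p * 2 ^ h)) h′ p′ → NextLeaf h p h′ p′
  leader-after {h} {p} {h′} {p′} R≤2^D v u (start<R+1 , R+1≤end) with p′ * 2 ^ h′ <? suc p * 2 ^ h
  ... | no  start≮R = ≤-antisym (≮⇒≥ start≮R) (s≤s⁻¹ start<R+1)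
  ... | yes start<R
    with refl , refl ← leader-unique R≤2^D v u (last-leafIn h p)
                                     (start<R , ≤-trans (n≤1+n _) R+1≤end)
    = contradiction R+1≤end (n≮n _)

  leader-before : ∀ {h p h′ p′} → p * 2 ^ h < 2 ^ D → IsLeader D act h′ p′ → IsLeader D act h p →
    LeafIn (p * 2 ^ h) h′ p′ → NextLeaf h′ p′ h p
  leader-before {h} {p} {h′} {p′} L<2^D u v (start<L , L≤end) with p * 2 ^ h <? suc p′ * 2 ^ h′
  ... | no  L≮end = ≤-antisym (≮⇒≥ L≮end) L≤end
  ... | yes L<end
    with refl , refl ← leader-unique L<2^D v u (first-leafIn h p) (m<n⇒m<1+n start<L , L<end)
    = contradiction start<L (n≮n _)

  module Leaves {n : ℕ} (n<2^D : n < 2 ^ D) (root-passive : act D 0 ≡ false)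
    (leaf-active : ∀ j → 1 ≤ j → j ≤ n → act 0 (j ∸ 1) ≡ true) where

    leader-of-leaf : ∀ {x} → 1 ≤ x → x ≤ n → LeaderOf D act x
    leader-of-leaf {x} 1≤x x≤n =
      leader-of root-passive (≤-trans x≤n (<⇒≤ n<2^D)) 1≤x (leaf-active x 1≤x x≤n)

    next-leader : ∀ {h p} → IsLeader D act h p → suc p * 2 ^ h < n →
      ∃₂ λ h′ p′ → IsLeader D act h′ p′ × NextLeaf h p h′ p′
    next-leader v R<n =
      let h′ , p′ , u , R+1∈u = leader-of-leaf (s≤s z≤n) R<n
      in  h′ , p′ , u , leader-after (<⇒≤ (<-trans R<n n<2^D)) v u R+1∈u

    previous-leader : ∀ {h p} → IsLeader D act h p → 1 ≤ p * 2 ^ h → p * 2 ^ h ≤ n →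
      ∃₂ λ h′ p′ → IsLeader D act h′ p′ × NextLeaf h′ p′ h p
    previous-leader v 1≤L L≤n =
      let h′ , p′ , u , L∈u = leader-of-leaf 1≤L L≤n
      in  h′ , p′ , u , leader-before (≤-<-trans L≤n n<2^D) u v L∈u

    leader-far : Balanced D act → ∀ {i h p j} → IsLeader D act h p → LeafIn i h p → i ≤ n →
      1 ≤ j → j ≤ n → InNoLeaderOfHeight≥ D act (h ∸ 2) j → 2 ^ (h ∸ 2) ≤ ∣ i - j ∣
    leader-far balanced {i} {h} {p} {j} v (L<i , i≤R) i≤n 1≤j j≤n avoids
      with j ≤? p * 2 ^ h | suc p * 2 ^ h <? j
    ... | yes j≤L | _ =
      let _ , _ , u , u→v = previous-leader v (≤-trans 1≤j j≤L) (≤-trans (<⇒≤ L<i) i≤n)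
      in  subst (2 ^ (h ∸ 2) ≤_) (∣-∣-comm j i) (m+o≤n⇒o≤∣m-n∣ j i (2 ^ (h ∸ 2))
            (≤-trans (gap-before balanced u v u→v j≤L avoids) (<⇒≤ L<i)))
    ... | no _ | yes R<j =
      let _ , _ , u , v→u = next-leader v (<-≤-trans R<j j≤n)
      in  m+o≤n⇒o≤∣m-n∣ i j (2 ^ (h ∸ 2))
            (≤-trans (+-monoˡ-≤ (2 ^ (h ∸ 2)) i≤R) (gap-after balanced v u v→u R<j avoids))
    ... | no j≰L | no j≮R = contradiction (≰⇒> j≰L , ≮⇒≥ j≮R) (avoids v (m∸n≤m h 2))

lemma14 : (n D : ℕ) → 1 ≤ n → suc n ≤ 2 ^ D → 2 ^ D ≤ 2 * n →
    (t : ℤ) (s : ℕ → Maybe ℤ) →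
    (∀ j k → 1 ≤ j → j ≤ n → s j ≡ just k → k ℤ.< t) →
    (act : Labelling) →
    (∀ j → 1 ≤ j → j ≤ n → act 0 (j ∸ 1) ≡ true) →
    (∀ j → n < j → j ≤ 2 ^ D → act 0 (j ∸ 1) ≡ false) →
    (∀ h p → IsNode D (suc h) p → act (suc h) p ≡ true →
      (act h (2 * p) ≡ true) × (act h (2 * p + 1) ≡ true)) →
    (∀ h p h' p' → IsLeader D act h p → IsLeader D act h' p' →
      NextLeaf h p h' p' → ∣ h - h' ∣ ≤ 2) →
    (∀ j k → 1 ≤ j → j ≤ n → s j ≡ just k →
      (ancLevel t k ≤ D) × (act (ancLevel t k) (ancPos j (ancLevel t k)) ≡ false)) →
    (i : ℕ) → 1 ≤ i → i ≤ n →
    (h p : ℕ) → IsLeader D act h p → LeafIn i h p →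
    ∀ j k → 1 ≤ j → j ≤ n → s j ≡ just k →
    + (2 ^ (h ∸ 4)) ℤ.≤ + (suc ∣ i - j ∣) ℤ.* (ℤ.1ℤ ℤ.+ t ℤ.- k)
lemma14 n D _ n<2^D _ t s s<t act leaf-active leaf-passive closed balanced ancestor-passive
        i _ i≤n h p v i∈v j k 1≤j j≤n sj≡k = begin
  + (2 ^ (h ∸ 4))                 ≤⟨ ℤ.+≤+ (≤-trans (^-monoʳ-≤ 2 (∸-monoʳ-≤ h (m≤m+n 2 2))) bound) ⟩
  + (suc ∣ i - j ∣ * N)           ≡⟨ ℤₚ.pos-* (suc ∣ i - j ∣) N ⟩
  + suc ∣ i - j ∣ ℤ.* + N         ≡⟨ cong (+ suc ∣ i - j ∣ ℤ.*_) 1+t-k≡N ⟨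
  + suc ∣ i - j ∣ ℤ.* (ℤ.1ℤ ℤ.+ t ℤ.- k) ∎
  where
  open ℤₚ.≤-Reasoning
  root-passive : act D 0 ≡ false
  root-passive =
    passive-leaf⇒passive-root {D} {act} closed ≤-refl (leaf-passive (2 ^ D) n<2^D ≤-refl)
  open Leaves {D} {act} closed n<2^D root-passive leaf-active
  N : ℕ
  N = suc ℤ.∣ t ℤ.- k ∣
  1+t-k≡N : ℤ.1ℤ ℤ.+ t ℤ.- k ≡ + N
  1+t-k≡N = 1+i-j≡+[1+∣i-j∣] (ℤₚ.<⇒≤ (s<t j k 1≤j j≤n sj≡k))
  a : ℕ
  a = ancLevel t k
  2^[a∸1]≤N : 2 ^ (a ∸ 1) ≤ N
  2^[a∸1]≤N = subst (λ z → 2 ^ (⌈log₂ ℤ.∣ z ∣ ⌉ ∸ 1) ≤ N) (sym 1+t-k≡N)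
                (2^[⌈log₂[1+n]⌉∸1]≤1+n ℤ.∣ t ℤ.- k ∣)
  bound : 2 ^ (h ∸ 2) ≤ suc ∣ i - j ∣ * N
  bound with a ≤? h ∸ 2
  ... | yes a≤h∸2 =
    ≤-trans (leader-far balanced v i∈v i≤n 1≤j j≤n avoids) (≤-trans (n≤1+n _) (m≤m*n _ N))
    where
    avoids : InNoLeaderOfHeight≥ D act (h ∸ 2) j
    avoids u h∸2≤ = passive-ancestor⇒inNoLeader {D} {act} closed (≤-trans j≤n (<⇒≤ n<2^D))
                      (proj₂ (ancestor-passive j k 1≤j j≤n sj≡k)) u (≤-trans a≤h∸2 h∸2≤)
  ... | no a≰h∸2 =
    ≤-trans (^-monoʳ-≤ 2 (∸-monoˡ-≤ 1 (≰⇒> a≰h∸2))) (≤-trans 2^[a∸1]≤N (m≤n*m N (suc ∣ i - j ∣)))
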